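{- For $n\ge1$ and positive integers $a_1,\dots,a_{n+1},b_1,\dots,b_n$, \[ \sum_{\sigma\in\mathfrak S_{n+1}}\mathrm{sgn}(\sigma)\,f_{b_1}\big(x_{a_{\sigma(1)}},\,x_{a_{\sigma(2)}}x_{b_2}x_{a_{\sigma(3)}}x_{b_3}\cdots x_{a_{\sigma(n)}}x_{b_n}x_{a_{\sigma(n+1)}}\big)=0. \]
   Context: $\mathfrak X=\mathbb Q\langle x_1,x_2,\dots\rangle$ is the free non-commutative $\mathbb Q$-algebra. For $c\ge1$, $f_c:\mathfrak X\times\mathfrak X\to\mathfrak X$ are the $\mathbb Q$-bilinear maps determined recursively by $f_c(u,1)=f_c(1,u)=x_cu$ and $f_c(x_au,x_bv)=x_cf_a(u,x_bv)+x_cf_b(x_au,v)-f_{c+a+b}(u,v)$ for $u,v\in\mathfrak X$, $a,b\ge1$. -}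

module Defs where

open import Data.Nat using (ℕ; zero; suc; _+_; _<ᵇ_)
open import Data.Bool using (Bool; true; false; if_then_else_)
open import Data.Fin using (Fin; toℕ)
open import Data.List using (List; []; _∷_; _++_; map; concatMap; foldr)
open import Data.List.Properties using (≡-dec)
open import Data.Nat.Properties using () renaming (_≟_ to _≟ℕ_)
open import Data.Product using (_×_; _,_)
open import Data.Rational using (ℚ; 0ℚ; 1ℚ; -_; _*_) renaming (_+_ to _+ℚ_)
open import Relation.Nullary using (yes; no)

-- The free non-commutative ℚ-algebra 𝔛 = ℚ⟨x₁,x₂,…⟩.
-- A monomial (word) x_{i₁}⋯x_{i_k} is the list [i₁,…,i_k]; the empty word is 1.
-- An element of 𝔛 is represented by a finite formal ℚ-linear combination of
-- words (a list of (coefficient, word) pairs); two representations denote the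
-- same element of 𝔛 iff all their word-coefficients agree (see `coeff`).

Word : Set
Word = List ℕ

𝔛 : Set
𝔛 = List (ℚ × Word)

coeff : 𝔛 → Word → ℚ
coeff [] w = 0ℚ
coeff ((q , u) ∷ P) w with ≡-dec _≟ℕ_ u w
... | yes _ = q +ℚ coeff P w
... | no  _ = coeff P w

IsZero : 𝔛 → Set
IsZero P = ∀ (w : Word) → coeff P w ≡ 0ℚ
  where open import Relation.Binary.PropositionalEquality using (_≡_)

mono : Word → 𝔛
mono w = (1ℚ , w) ∷ []

_·_ : ℚ → 𝔛 → 𝔛
q · P = map (λ { (p , u) → (q * p , u) }) P

x[_]* : ℕ → 𝔛 → 𝔛
x[ c ]* P = map (λ { (p , u) → (p , c ∷ u) }) P

fw : ℕ → Word → Word → 𝔛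
fw c [] v = mono (c ∷ v)
fw c (a ∷ u) [] = mono (c ∷ a ∷ u)
fw c (a ∷ u) (b ∷ v) =
  x[ c ]* (fw a u (b ∷ v)) ++ x[ c ]* (fw b (a ∷ u) v) ++ ((- 1ℚ) · fw (c + a + b) u v)

f : ℕ → 𝔛 → 𝔛 → 𝔛
f c P Q = concatMap (λ { (p , u) → concatMap (λ { (q , v) → (p * q) · fw c u v }) Q }) P

∑ : List 𝔛 → 𝔛
∑ = foldr _++_ []

insertions : {A : Set} → A → List A → List (List A)
insertions x [] = (x ∷ []) ∷ []
insertions x (y ∷ ys) = (x ∷ y ∷ ys) ∷ map (y ∷_) (insertions x ys)

perms : {A : Set} → List A → List (List A)
perms [] = [] ∷ []
perms (x ∷ xs) = concatMap (insertions x) (perms xs)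

inversions : {m : ℕ} → List (Fin m) → ℕ
inversions [] = 0
inversions (x ∷ xs) = foldr (λ y k → if toℕ y <ᵇ toℕ x then suc k else k) 0 xs + inversions xs

sgnℚ : ℕ → ℚ
sgnℚ zero = 1ℚ
sgnℚ (suc k) = - sgnℚ k

sgn : {m : ℕ} → List (Fin m) → ℚ
sgn s = sgnℚ (inversions s)

interleave : List ℕ → List ℕ → Word
interleave [] zs = []
interleave (y ∷ ys) zs = y ∷ go ys zs
  where
  go : List ℕ → List ℕ → Word
  go (y ∷ ys) (z ∷ zs) = z ∷ y ∷ go ys zs
  go _ _ = []

open import Data.List using (tabulate)
open import Data.Fin using (zero; suc) renaming (_≟_ to _≟F_)
open import Data.Fin using (Fin) public

allFinL : (m : ℕ) → List (Fin m)
allFinL m = tabulate (λ i → i)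

-- For n = suc k, positive integers a₁,…,a_{n+1} (a : Fin (n+1) → ℕ, a i = a_{i+1})
-- and b₁,…,b_n (b : Fin n → ℕ, b i = b_{i+1}), the summand for σ given as the list
-- [σ(1),…,σ(n+1)] (values shifted to 0-based):
--   sgn(σ) f_{b₁}( x_{a_{σ(1)}} , x_{a_{σ(2)}} x_{b₂} x_{a_{σ(3)}} ⋯ x_{b_n} x_{a_{σ(n+1)}} ).
summand : (k : ℕ) → (Fin (suc (suc k)) → ℕ) → (Fin (suc k) → ℕ) → List (Fin (suc (suc k))) → 𝔛
summand k a b [] = []
summand k a b (s₁ ∷ rest) =
  sgn (s₁ ∷ rest) · f (b zero) (mono (a s₁ ∷ [])) (mono (interleave (map a rest) (tabulate (λ j → b (suc j)))))

altSum : (k : ℕ) → (Fin (suc (suc k)) → ℕ) → (Fin (suc k) → ℕ) → 𝔛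
altSum k a b = ∑ (map (summand k a b) (perms (allFinL (suc (suc k)))))

-- Fix a word w and let Φ(σ) be the coefficient of w in
-- f_{b₁}(x_{a_{σ(1)}}, x_{a_{σ(2)}} x_{b₂} x_{a_{σ(3)}} ⋯ x_{b_n} x_{a_{σ(n+1)}}). Expanding f_{b₁} and
-- then f_{a_{σ(2)}} by the recursion writes Φ as a part symmetric in σ(1), σ(2) plus the coefficient
-- of w in x_{b₁} x_{a_{σ(2)}} f_{b₂}(x_{a_{σ(1)}}, x_{a_{σ(3)}} x_{b₃} ⋯), which is the function of the
-- same kind for n − 1, evaluated at σ with σ(2) deleted. By induction on n, Φ is therefore a sum of
-- functions each invariant under exchanging σ(1) with some σ(j), and the alternating sum over 𝔖_{n+1}
-- of such a function vanishes because composing with that transposition reverses signs.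
module Submission where

open import Defs
open import Function using (_∘_)
open import Data.Bool using (true; false; if_then_else_; T)
open import Data.Empty using (⊥-elim)
open import Data.Unit using (tt)
open import Data.Fin using (zero; suc; toℕ)
open import Data.Fin.Properties using (toℕ-injective)
open import Data.Nat using (ℕ; zero; suc; _≤_; s≤s; z≤n; _∸_; _<ᵇ_)
import Data.Nat as ℕ
import Data.Nat.Properties as ℕₚ
open import Data.Product using (_×_; _,_; map₂; uncurry)
open import Data.List using (List; []; _∷_; _++_; map; concatMap; foldr; length; tabulate)
open import Data.List.Properties using (≡-dec; map-++; ++-identityʳ; length-tabulate)
open import Data.List.Relation.Binary.Permutation.Propositional
  using (_↭_; prep; swap; ↭-sym; ↭⇒↭ₛ) renaming (refl to ↭-refl; trans to ↭-trans)
open import Data.List.Relation.Binary.Permutation.Propositional.Properties using (↭-length)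
import Data.List.Relation.Binary.Permutation.Setoid.Properties as ↭ₛ
open import Data.List.Relation.Unary.All using (All; []; _∷_)
import Data.List.Relation.Unary.All as All
import Data.List.Relation.Unary.All.Properties as All
open import Data.List.Relation.Unary.AllPairs using (_∷_)
open import Data.List.Relation.Unary.Unique.Propositional using (Unique)
open import Data.List.Relation.Unary.Unique.Propositional.Properties using (tabulate⁺)
open import Data.Rational using (ℚ; 0ℚ; 1ℚ; ½; _+_; _*_; -_)
open import Data.Rational.Properties
  using ( +-*-commutativeRing; +-0-group; _≟_; +-identityˡ; +-identityʳ; +-assoc; +-comm
        ; *-identityˡ; *-identityʳ; *-zeroˡ; *-zeroʳ; *-assoc; *-distribˡ-+
        ; neg-distrib-+; neg-distribˡ-* )
open import Relation.Binary.Definitions using (tri<; tri≈; tri>)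
open import Relation.Binary.PropositionalEquality
open import Relation.Binary.PropositionalEquality.Properties using (setoid)
open import Relation.Nullary using (Dec; yes; no)
open import Relation.Nullary.Decidable using (dec⇒maybe)
open import Tactic.RingSolver using (solve-∀)
open import Tactic.RingSolver.Core.AlmostCommutativeRing using (AlmostCommutativeRing; fromCommutativeRing)
open import Algebra.Properties.Group +-0-group using (∙-cancelʳ; ⁻¹-involutive)
open import Algebra.Properties.CommutativeSemigroup ℕₚ.+-commutativeSemigroup
  using (x∙yz≈y∙xz; xy∙z≈xz∙y)
open ≡-Reasoning

ℚ-ring : AlmostCommutativeRing _ _
ℚ-ring = fromCommutativeRing +-*-commutativeRing (λ x → dec⇒maybe (0ℚ ≟ x))

module _ {A : Set} where

  sumOver : (A → ℚ) → List A → ℚ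
  sumOver F []       = 0ℚ
  sumOver F (x ∷ xs) = F x + sumOver F xs

  sumOver-++ : ∀ F xs ys → sumOver F (xs ++ ys) ≡ sumOver F xs + sumOver F ys
  sumOver-++ F []       ys = sym (+-identityˡ _)
  sumOver-++ F (x ∷ xs) ys = trans (cong (F x +_) (sumOver-++ F xs ys)) (sym (+-assoc (F x) _ _))

  sumOver-cong : ∀ {F G} xs → (∀ x → F x ≡ G x) → sumOver F xs ≡ sumOver G xs
  sumOver-cong []       F≗G = refl
  sumOver-cong (x ∷ xs) F≗G = cong₂ _+_ (F≗G x) (sumOver-cong xs F≗G)

  sumOver-congᴬ : ∀ {F G xs} → All (λ x → F x ≡ G x) xs → sumOver F xs ≡ sumOver G xs
  sumOver-congᴬ []           = refl
  sumOver-congᴬ (Fx≡Gx ∷ eq) = cong₂ _+_ Fx≡Gx (sumOver-congᴬ eq)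

  sumOver-+ : ∀ F G xs → sumOver (λ x → F x + G x) xs ≡ sumOver F xs + sumOver G xs
  sumOver-+ F G []       = refl
  sumOver-+ F G (x ∷ xs) =
    trans (cong (F x + G x +_) (sumOver-+ F G xs)) (interchange (F x) (G x) _ _)
    where
    interchange : ∀ a b c d → a + b + (c + d) ≡ a + c + (b + d)
    interchange = solve-∀ ℚ-ring

  sumOver-neg : ∀ F xs → sumOver (λ x → - F x) xs ≡ - sumOver F xs
  sumOver-neg F []       = refl
  sumOver-neg F (x ∷ xs) = trans (cong (- F x +_) (sumOver-neg F xs)) (sym (neg-distrib-+ (F x) _))

  sumOver-*ˡ : ∀ q F xs → sumOver (λ x → q * F x) xs ≡ q * sumOver F xs
  sumOver-*ˡ q F []       = sym (*-zeroʳ q)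
  sumOver-*ˡ q F (x ∷ xs) =
    trans (cong (q * F x +_) (sumOver-*ˡ q F xs)) (sym (*-distribˡ-+ q (F x) _))

sumOver-map : {A B : Set} (F : B → ℚ) (g : A → B) (xs : List A) →
              sumOver F (map g xs) ≡ sumOver (F ∘ g) xs
sumOver-map F g []       = refl
sumOver-map F g (x ∷ xs) = cong (F (g x) +_) (sumOver-map F g xs)

sumOver-concatMap : {A B : Set} (F : B → ℚ) (g : A → List B) (xs : List A) →
                    sumOver F (concatMap g xs) ≡ sumOver (sumOver F ∘ g) xs
sumOver-concatMap F g []       = refl
sumOver-concatMap F g (x ∷ xs) =
  trans (sumOver-++ F (g x) _) (cong (sumOver F (g x) +_) (sumOver-concatMap F g xs))

module _ {A : Set} where

  insertions-↭ : ∀ (x : A) τ → All (_↭ x ∷ τ) (insertions x τ)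
  insertions-↭ x []       = ↭-refl ∷ []
  insertions-↭ x (y ∷ ys) =
    ↭-refl ∷ All.map⁺ (All.map (λ p → ↭-trans (prep y p) (swap y x ↭-refl)) (insertions-↭ x ys))

  perms-↭ : ∀ (xs : List A) → All (_↭ xs) (perms xs)
  perms-↭ []       = ↭-refl ∷ []
  perms-↭ (x ∷ xs) = All.concat⁺ (All.map⁺ (All.map (λ {τ} τ↭xs →
    All.map (λ σ↭xτ → ↭-trans σ↭xτ (prep x τ↭xs)) (insertions-↭ x τ)) (perms-↭ xs)))

  sumOver-perms-cong : ∀ {F G : List A → ℚ} xs → (∀ σ → σ ↭ xs → F σ ≡ G σ) →
                       sumOver F (perms xs) ≡ sumOver G (perms xs)
  sumOver-perms-cong xs F≗G = sumOver-congᴬ (All.map (F≗G _) (perms-↭ xs))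

  insertionSum : A → (List A → ℚ) → List A → ℚ
  insertionSum x F []       = F (x ∷ [])
  insertionSum x F (y ∷ ys) = F (x ∷ y ∷ ys) + insertionSum x (λ l → F (y ∷ l)) ys

  sumOver-insertions : ∀ x F τ → sumOver F (insertions x τ) ≡ insertionSum x F τ
  sumOver-insertions x F []       = +-identityʳ _
  sumOver-insertions x F (y ∷ ys) = cong (F (x ∷ y ∷ ys) +_)
    (trans (sumOver-map F (y ∷_) (insertions x ys)) (sumOver-insertions x (λ l → F (y ∷ l)) ys))

  sumOver-perms-∷ : ∀ F x xs → sumOver F (perms (x ∷ xs)) ≡ sumOver (insertionSum x F) (perms xs)
  sumOver-perms-∷ F x xs = trans (sumOver-concatMap F (insertions x) (perms xs))
                                 (sumOver-cong (perms xs) (sumOver-insertions x F))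

  swapAt : ℕ → List A → List A
  swapAt _       []          = []
  swapAt zero    (x ∷ [])    = x ∷ []
  swapAt zero    (x ∷ y ∷ r) = y ∷ x ∷ r
  swapAt (suc j) (x ∷ r)     = x ∷ swapAt j r

  swapAt-↭ : ∀ j (l : List A) → swapAt j l ↭ l
  swapAt-↭ _       []          = ↭-refl
  swapAt-↭ zero    (x ∷ [])    = ↭-refl
  swapAt-↭ zero    (x ∷ y ∷ r) = swap y x ↭-refl
  swapAt-↭ (suc j) (x ∷ r)     = prep x (swapAt-↭ j r)

  insertionSumBelow : ℕ → A → (List A → ℚ) → List A → ℚ
  insertionSumBelow zero    x F τ        = 0ℚ
  insertionSumBelow (suc j) x F []       = F (x ∷ [])
  insertionSumBelow (suc j) x F (y ∷ ys) =
    F (x ∷ y ∷ ys) + insertionSumBelow j x (λ l → F (y ∷ l)) ys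

  insertionSumFrom : ℕ → A → (List A → ℚ) → List A → ℚ
  insertionSumFrom zero    x F τ        = insertionSum x F τ
  insertionSumFrom (suc j) x F []       = 0ℚ
  insertionSumFrom (suc j) x F (y ∷ ys) = insertionSumFrom j x (λ l → F (y ∷ l)) ys

  insertionSumBelow-swapAt : ∀ j x F y ys →
    insertionSumBelow (suc j) x F (swapAt j (y ∷ ys))
      ≡ F (x ∷ swapAt j (y ∷ ys)) + insertionSumBelow j x (λ l → F (y ∷ l)) (swapAt (j ∸ 1) ys)
  insertionSumBelow-swapAt zero    x F y []       = refl
  insertionSumBelow-swapAt zero    x F y (_ ∷ _)  = refl
  insertionSumBelow-swapAt (suc j) x F y ys       = refl

  -- Swapping the entries j, j+1 of the insertion of x into τ at position p yields the insertion
  -- into swapAt (j ∸ 1) τ at p if p < j, into swapAt j τ at p if p > j+1, and exchanges p = j, j+1.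
  insertionSum-swapAt : ∀ j x F τ →
    insertionSum x (F ∘ swapAt j) τ + insertionSumBelow j x F τ + insertionSumFrom (2 ℕ.+ j) x F τ
      ≡ insertionSum x F τ + insertionSumBelow j x F (swapAt (j ∸ 1) τ)
        + insertionSumFrom (2 ℕ.+ j) x F (swapAt j τ)
  insertionSum-swapAt zero    x F []            = refl
  insertionSum-swapAt zero    x F (y ∷ [])      = cong (λ s → s + 0ℚ + 0ℚ) (+-comm (F (y ∷ x ∷ [])) _)
  insertionSum-swapAt zero    x F (y ∷ y′ ∷ ys) =
    rearrange (F (y ∷ x ∷ y′ ∷ ys)) (F (x ∷ y ∷ y′ ∷ ys)) _ _
    where
    rearrange : ∀ a b c d → a + (b + c) + 0ℚ + d ≡ b + (a + d) + 0ℚ + c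
    rearrange = solve-∀ ℚ-ring
  insertionSum-swapAt (suc j) x F []       = refl
  insertionSum-swapAt (suc j) x F (y ∷ ys) = begin
    p + t + (q + u) + h     ≡⟨ regroup p q t u h ⟩
    p + q + (t + u + h)     ≡⟨ cong (p + q +_) (insertionSum-swapAt j x G ys) ⟩
    p + q + (t′ + u′ + h′)  ≡⟨ regroup′ p q t′ u′ h′ ⟩
    q + t′ + (p + u′) + h′  ≡⟨ cong (λ s → q + t′ + s + h′) (insertionSumBelow-swapAt j x F y ys) ⟨
    q + t′ + insertionSumBelow (suc j) x F (swapAt j (y ∷ ys)) + h′ ∎
    where
    G = λ l → F (y ∷ l)
    p = F (x ∷ swapAt j (y ∷ ys))
    q = F (x ∷ y ∷ ys)
    t = insertionSum x (G ∘ swapAt j) ys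
    u = insertionSumBelow j x G ys
    h = insertionSumFrom (2 ℕ.+ j) x G ys
    t′ = insertionSum x G ys
    u′ = insertionSumBelow j x G (swapAt (j ∸ 1) ys)
    h′ = insertionSumFrom (2 ℕ.+ j) x G (swapAt j ys)
    regroup : ∀ a b c d e → a + c + (b + d) + e ≡ a + b + (c + d + e)
    regroup = solve-∀ ℚ-ring
    regroup′ : ∀ a b c d e → a + b + (c + d + e) ≡ b + c + (a + d) + e
    regroup′ = solve-∀ ℚ-ring

  sumOver-perms-swapAt : ∀ j xs F → sumOver (F ∘ swapAt j) (perms xs) ≡ sumOver F (perms xs)
  sumOver-perms-swapAt j []       F = refl
  sumOver-perms-swapAt j (x ∷ xs) F = begin
    sumOver (F ∘ swapAt j) (perms (x ∷ xs))       ≡⟨ sumOver-perms-∷ (F ∘ swapAt j) x xs ⟩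
    sumOver (insertionSum x (F ∘ swapAt j)) P     ≡⟨ ∙-cancelʳ (ΣB + ΣU) _ _ cancellable ⟩
    sumOver (insertionSum x F) P                  ≡⟨ sumOver-perms-∷ F x xs ⟨
    sumOver F (perms (x ∷ xs))                    ∎
    where
    P = perms xs
    B = insertionSumBelow j x F
    U = insertionSumFrom (2 ℕ.+ j) x F
    ΣB = sumOver B P
    ΣU = sumOver U P
    sum3 : ∀ F G H →
           sumOver (λ τ → F τ + G τ + H τ) P ≡ sumOver F P + (sumOver G P + sumOver H P)
    sum3 F G H = trans (sumOver-+ (λ τ → F τ + G τ) H P)
                       (trans (cong (_+ sumOver H P) (sumOver-+ F G P)) (+-assoc (sumOver F P) _ _))
    cancellable : sumOver (insertionSum x (F ∘ swapAt j)) P + (ΣB + ΣU)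
                ≡ sumOver (insertionSum x F) P + (ΣB + ΣU)
    cancellable = begin
      sumOver (insertionSum x (F ∘ swapAt j)) P + (ΣB + ΣU)
        ≡⟨ sum3 _ B U ⟨
      sumOver (λ τ → insertionSum x (F ∘ swapAt j) τ + B τ + U τ) P
        ≡⟨ sumOver-cong P (insertionSum-swapAt j x F) ⟩
      sumOver (λ τ → insertionSum x F τ + B (swapAt (j ∸ 1) τ) + U (swapAt j τ)) P
        ≡⟨ sum3 _ _ _ ⟩
      sumOver (insertionSum x F) P + (sumOver (B ∘ swapAt (j ∸ 1)) P + sumOver (U ∘ swapAt j) P)
        ≡⟨ cong₂ (λ b u → sumOver (insertionSum x F) P + (b + u))
                 (sumOver-perms-swapAt (j ∸ 1) xs B) (sumOver-perms-swapAt j xs U) ⟩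
      sumOver (insertionSum x F) P + (ΣB + ΣU)
        ∎

  -- exchange i x r = (r[i] , r with r[i] replaced by x), and (x , r) if r is too short.
  exchange : ℕ → A → List A → A × List A
  exchange i       x []      = x , []
  exchange zero    x (y ∷ r) = y , x ∷ r
  exchange (suc i) x (y ∷ r) = map₂ (y ∷_) (exchange i x r)

  -- swapHead i transposes the entries at positions 0 and i + 1.
  swapHead : ℕ → List A → List A
  swapHead i []      = []
  swapHead i (x ∷ r) = uncurry _∷_ (exchange i x r)

  swapHead-↭ : ∀ i (l : List A) → swapHead i l ↭ l
  swapHead-↭ i []      = ↭-refl
  swapHead-↭ i (x ∷ r) = exchange-↭ i r
    where
    exchange-↭ : ∀ i r → uncurry _∷_ (exchange i x r) ↭ x ∷ r
    exchange-↭ i       []      = ↭-refl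
    exchange-↭ zero    (y ∷ r) = swap y x ↭-refl
    exchange-↭ (suc i) (y ∷ r) =
      ↭-trans (swap _ y ↭-refl) (↭-trans (prep y (exchange-↭ i r)) (swap y x ↭-refl))

  swapHead-zero : ∀ (l : List A) → swapHead 0 l ≡ swapAt 0 l
  swapHead-zero []          = refl
  swapHead-zero (x ∷ [])    = refl
  swapHead-zero (x ∷ y ∷ r) = refl

  swapHead-suc : ∀ i (l : List A) → 3 ℕ.+ i ≤ length l →
                 swapHead (suc i) l ≡ swapAt (suc i) (swapHead i (swapAt (suc i) l))
  swapHead-suc i (x ∷ r) (s≤s i+2≤∣r∣) = cong (uncurry _∷_) (exchange-suc i r i+2≤∣r∣)
    where
    exchange-suc : ∀ i r → 2 ℕ.+ i ≤ length r →
                   exchange (suc i) x r ≡ map₂ (swapAt i) (exchange i x (swapAt i r))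
    exchange-suc zero    (y ∷ y′ ∷ r) _           = refl
    exchange-suc zero    (y ∷ [])     (s≤s ())
    exchange-suc (suc i) (y ∷ r)      (s≤s i+2≤∣r∣) = cong (map₂ (y ∷_)) (exchange-suc i r i+2≤∣r∣)

  sumOver-perms-swapHead : ∀ i xs F → 2 ℕ.+ i ≤ length xs →
                           sumOver (F ∘ swapHead i) (perms xs) ≡ sumOver F (perms xs)
  sumOver-perms-swapHead zero    xs F _ =
    trans (sumOver-cong (perms xs) (cong F ∘ swapHead-zero)) (sumOver-perms-swapAt 0 xs F)
  sumOver-perms-swapHead (suc i) xs F i+3≤∣xs∣ = begin
    sumOver (F ∘ swapHead (suc i)) (perms xs)
      ≡⟨ sumOver-perms-cong xs (λ σ σ↭xs → cong F (swapHead-suc i σ (long σ↭xs))) ⟩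
    sumOver (F ∘ swapAt (suc i) ∘ swapHead i ∘ swapAt (suc i)) (perms xs)
      ≡⟨ sumOver-perms-swapAt (suc i) xs (F ∘ swapAt (suc i) ∘ swapHead i) ⟩
    sumOver (F ∘ swapAt (suc i) ∘ swapHead i) (perms xs)
      ≡⟨ sumOver-perms-swapHead i xs (F ∘ swapAt (suc i)) (ℕₚ.m+n≤o⇒n≤o 1 i+3≤∣xs∣) ⟩
    sumOver (F ∘ swapAt (suc i)) (perms xs)
      ≡⟨ sumOver-perms-swapAt (suc i) xs F ⟩
    sumOver F (perms xs) ∎
    where
    long : ∀ {σ} → σ ↭ xs → 3 ℕ.+ i ≤ length σ
    long σ↭xs = subst (3 ℕ.+ i ≤_) (sym (↭-length σ↭xs)) i+3≤∣xs∣

sgnℚ-+-flip : ∀ m {n n′} → sgnℚ n ≡ - sgnℚ n′ → sgnℚ (m ℕ.+ n) ≡ - sgnℚ (m ℕ.+ n′)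
sgnℚ-+-flip zero    flip = flip
sgnℚ-+-flip (suc m) flip = cong -_ (sgnℚ-+-flip m flip)

module _ {m : ℕ} where

  countBelow : Fin m → List (Fin m) → ℕ
  countBelow x = foldr (λ y k → if toℕ y <ᵇ toℕ x then suc k else k) 0

  countBelow-swapAt : ∀ x j r → countBelow x (swapAt j r) ≡ countBelow x r
  countBelow-swapAt x _       []          = refl
  countBelow-swapAt x zero    (u ∷ [])    = refl
  countBelow-swapAt x zero    (u ∷ v ∷ r) with toℕ u <ᵇ toℕ x | toℕ v <ᵇ toℕ x
  ... | true  | true  = refl
  ... | true  | false = refl
  ... | false | true  = refl
  ... | false | false = refl
  countBelow-swapAt x (suc j) (u ∷ r) with toℕ u <ᵇ toℕ x
  ... | true  = cong suc (countBelow-swapAt x j r)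
  ... | false = countBelow-swapAt x j r

  sgn-swapFront : ∀ a b r → a ≢ b → sgn (b ∷ a ∷ r) ≡ - sgn (a ∷ b ∷ r)
  sgn-swapFront a b r a≢b with toℕ a <ᵇ toℕ b in a<b | toℕ b <ᵇ toℕ a in b<a
  ... | true  | true  = ⊥-elim (ℕₚ.<-asym (ℕₚ.<ᵇ⇒< (toℕ a) (toℕ b) (subst T (sym a<b) tt))
                                         (ℕₚ.<ᵇ⇒< (toℕ b) (toℕ a) (subst T (sym b<a) tt)))
  ... | true  | false = cong (-_ ∘ sgnℚ) (x∙yz≈y∙xz (countBelow b r) (countBelow a r) _)
  ... | false | true  = trans (sym (⁻¹-involutive _))
                              (cong (-_ ∘ -_ ∘ sgnℚ) (x∙yz≈y∙xz (countBelow b r) (countBelow a r) _))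
  ... | false | false with ℕₚ.<-cmp (toℕ a) (toℕ b)
  ...   | tri< a<b′ _ _ = ⊥-elim (subst T a<b (ℕₚ.<⇒<ᵇ a<b′))
  ...   | tri≈ _ a≡b _  = ⊥-elim (a≢b (toℕ-injective a≡b))
  ...   | tri> _ _ b<a′ = ⊥-elim (subst T b<a (ℕₚ.<⇒<ᵇ b<a′))

  sgn-swapAt : ∀ j (σ : List (Fin m)) → Unique σ → 2 ℕ.+ j ≤ length σ →
               sgn (swapAt j σ) ≡ - sgn σ
  sgn-swapAt zero    (a ∷ b ∷ r) ((a≢b ∷ _) ∷ _) _ = sgn-swapFront a b r a≢b
  sgn-swapAt zero    (a ∷ [])    _               (s≤s ())
  sgn-swapAt (suc j) (a ∷ r)     (_ ∷ r-unique)  (s≤s j+2≤∣r∣) =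
    trans (cong (λ c → sgnℚ (c ℕ.+ inversions (swapAt j r))) (countBelow-swapAt a j r))
          (sgnℚ-+-flip (countBelow a r) (sgn-swapAt j r r-unique j+2≤∣r∣))

  unique-↭ : ∀ {σ τ : List (Fin m)} → σ ↭ τ → Unique σ → Unique τ
  unique-↭ σ↭τ = ↭ₛ.Unique-resp-↭ (setoid (Fin m)) (↭⇒↭ₛ σ↭τ)

  sgn-swapHead : ∀ i (σ : List (Fin m)) → Unique σ → 2 ℕ.+ i ≤ length σ →
                 sgn (swapHead i σ) ≡ - sgn σ
  sgn-swapHead zero    σ σ-unique i+2≤∣σ∣ =
    trans (cong sgn (swapHead-zero σ)) (sgn-swapAt 0 σ σ-unique i+2≤∣σ∣)
  sgn-swapHead (suc i) σ σ-unique i+3≤∣σ∣ = begin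
    sgn (swapHead (suc i) σ)  ≡⟨ cong sgn (swapHead-suc i σ i+3≤∣σ∣) ⟩
    sgn (swapAt (suc i) σ₂)   ≡⟨ sgn-swapAt (suc i) σ₂ σ₂-unique (long σ₂↭σ₁) ⟩
    - sgn σ₂                  ≡⟨ cong -_ (sgn-swapHead i σ₁ σ₁-unique (ℕₚ.m+n≤o⇒n≤o 1 (long ↭-refl))) ⟩
    - - sgn σ₁                ≡⟨ ⁻¹-involutive _ ⟩
    sgn σ₁                    ≡⟨ sgn-swapAt (suc i) σ σ-unique i+3≤∣σ∣ ⟩
    - sgn σ                   ∎
    where
    σ₁ = swapAt (suc i) σ
    σ₂ = swapHead i σ₁
    σ₁-unique : Unique σ₁
    σ₁-unique = unique-↭ (↭-sym (swapAt-↭ (suc i) σ)) σ-unique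
    σ₂↭σ₁ : σ₂ ↭ σ₁
    σ₂↭σ₁ = swapHead-↭ i σ₁
    σ₂-unique : Unique σ₂
    σ₂-unique = unique-↭ (↭-sym σ₂↭σ₁) σ₁-unique
    long : ∀ {τ} → τ ↭ σ₁ → 3 ℕ.+ i ≤ length τ
    long τ↭σ₁ = subst (3 ℕ.+ i ≤_) (sym (trans (↭-length τ↭σ₁) (↭-length (swapAt-↭ (suc i) σ))))
                      i+3≤∣σ∣

x≡-x⇒x≡0 : ∀ {x} → x ≡ - x → x ≡ 0ℚ
x≡-x⇒x≡0 {x} x≡-x = begin
  x             ≡⟨ halve x ⟩
  ½ * (x + x)   ≡⟨ cong (λ y → ½ * (x + y)) x≡-x ⟩
  ½ * (x + - x) ≡⟨ cancel x ⟩
  0ℚ            ∎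
  where
  halve : ∀ x → x ≡ ½ * (x + x)
  halve = solve-∀ ℚ-ring
  cancel : ∀ x → ½ * (x + - x) ≡ 0ℚ
  cancel = solve-∀ ℚ-ring

module _ {m : ℕ} where

  alternatingSum : List (Fin m) → (List (Fin m) → ℚ) → ℚ
  alternatingSum L F = sumOver (λ σ → sgn σ * F σ) (perms L)

  data SumOfSymmetric (N : ℕ) : (List (Fin m) → ℚ) → Set where
    symmetric : ∀ {F} i → 2 ℕ.+ i ≤ N → (∀ σ → length σ ≡ N → F (swapHead i σ) ≡ F σ) →
                SumOfSymmetric N F
    plus      : ∀ {F G H} → SumOfSymmetric N F → SumOfSymmetric N G →
                (∀ σ → length σ ≡ N → H σ ≡ F σ + G σ) → SumOfSymmetric N H

  alternatingSum-vanishes : ∀ {N F} → SumOfSymmetric N F →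
                            ∀ L → Unique L → length L ≡ N → alternatingSum L F ≡ 0ℚ
  alternatingSum-vanishes {F = F} (symmetric i i+2≤N F-inv) L L-unique ∣L∣≡N = x≡-x⇒x≡0 (begin
    alternatingSum L F                                        ≡⟨ sumOver-perms-swapHead i L _ i+2≤∣L∣ ⟨
    sumOver (λ σ → sgn (swapHead i σ) * F (swapHead i σ)) P  ≡⟨ sumOver-perms-cong L sign-reversed ⟩
    sumOver (λ σ → - (sgn σ * F σ)) P                         ≡⟨ sumOver-neg _ P ⟩
    - alternatingSum L F                                      ∎)
    where
    P = perms L
    i+2≤∣L∣ = subst (2 ℕ.+ i ≤_) (sym ∣L∣≡N) i+2≤N
    sign-reversed : ∀ σ → σ ↭ L → sgn (swapHead i σ) * F (swapHead i σ) ≡ - (sgn σ * F σ)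
    sign-reversed σ σ↭L = begin
      sgn (swapHead i σ) * F (swapHead i σ) ≡⟨ cong₂ _*_ (sgn-swapHead i σ σ-unique i+2≤∣σ∣)
                                                          (F-inv σ (trans ∣σ∣≡∣L∣ ∣L∣≡N)) ⟩
      - sgn σ * F σ                         ≡⟨ neg-distribˡ-* (sgn σ) (F σ) ⟨
      - (sgn σ * F σ)                       ∎
      where
      σ-unique = unique-↭ (↭-sym σ↭L) L-unique
      ∣σ∣≡∣L∣ = ↭-length σ↭L
      i+2≤∣σ∣ = subst (2 ℕ.+ i ≤_) (sym ∣σ∣≡∣L∣) i+2≤∣L∣
  alternatingSum-vanishes {F = H} (plus {F} {G} F-sym G-sym H≗F+G) L L-unique ∣L∣≡N = begin
    alternatingSum L H                                   ≡⟨ sumOver-perms-cong L distribute ⟩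
    sumOver (λ σ → sgn σ * F σ + sgn σ * G σ) (perms L)  ≡⟨ sumOver-+ _ _ (perms L) ⟩
    alternatingSum L F + alternatingSum L G              ≡⟨ cong₂ _+_ (vanishes F-sym) (vanishes G-sym) ⟩
    0ℚ + 0ℚ                                              ≡⟨⟩
    0ℚ                                                   ∎
    where
    vanishes : ∀ {F} → SumOfSymmetric _ F → alternatingSum L F ≡ 0ℚ
    vanishes F-sym = alternatingSum-vanishes F-sym L L-unique ∣L∣≡N
    distribute : ∀ σ → σ ↭ L → sgn σ * H σ ≡ sgn σ * F σ + sgn σ * G σ
    distribute σ σ↭L = trans (cong (sgn σ *_) (H≗F+G σ (trans (↭-length σ↭L) ∣L∣≡N)))
                             (*-distribˡ-+ (sgn σ) (F σ) (G σ))

  SumOfSymmetric-zero : ∀ {N} → 2 ≤ N → SumOfSymmetric N (λ _ → 0ℚ)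
  SumOfSymmetric-zero 2≤N = symmetric 0 2≤N (λ _ _ → refl)

  SumOfSymmetric-scale : ∀ {N F} q → SumOfSymmetric N F → SumOfSymmetric N (λ σ → q * F σ)
  SumOfSymmetric-scale q (symmetric i i+2≤N F-inv) =
    symmetric i i+2≤N (λ σ ∣σ∣≡N → cong (q *_) (F-inv σ ∣σ∣≡N))
  SumOfSymmetric-scale q (plus {F} {G} F-sym G-sym H≗F+G) =
    plus (SumOfSymmetric-scale q F-sym) (SumOfSymmetric-scale q G-sym)
         (λ σ ∣σ∣≡N → trans (cong (q *_) (H≗F+G σ ∣σ∣≡N)) (*-distribˡ-+ q (F σ) (G σ)))

  dropSecond : (Fin m → ℚ) → (List (Fin m) → ℚ) → List (Fin m) → ℚ
  dropSecond g F (α ∷ β ∷ σ) = g β * F (α ∷ σ)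
  dropSecond g F _           = 0ℚ

  SumOfSymmetric-dropSecond : ∀ {N F} g → SumOfSymmetric N F →
                              SumOfSymmetric (suc N) (dropSecond g F)
  SumOfSymmetric-dropSecond {N} g (symmetric {F} i i+2≤N F-inv) =
    symmetric (suc i) (s≤s i+2≤N) invariant
    where
    invariant : ∀ σ → length σ ≡ suc N → dropSecond g F (swapHead (suc i) σ) ≡ dropSecond g F σ
    invariant []          _     = refl
    invariant (α ∷ [])    _     = refl
    invariant (α ∷ β ∷ σ) ∣σ∣≡N = cong (g β *_) (F-inv (α ∷ σ) (ℕₚ.suc-injective ∣σ∣≡N))
  SumOfSymmetric-dropSecond {N} g (plus {F} {G} {H} F-sym G-sym H≗F+G) =
    plus (SumOfSymmetric-dropSecond g F-sym) (SumOfSymmetric-dropSecond g G-sym) split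
    where
    split : ∀ σ → length σ ≡ suc N → dropSecond g H σ ≡ dropSecond g F σ + dropSecond g G σ
    split []          _     = refl
    split (α ∷ [])    _     = refl
    split (α ∷ β ∷ σ) ∣σ∣≡N =
      trans (cong (g β *_) (H≗F+G (α ∷ σ) (ℕₚ.suc-injective ∣σ∣≡N))) (*-distribˡ-+ (g β) _ _)

𝟙 : {P : Set} → Dec P → ℚ
𝟙 (yes _) = 1ℚ
𝟙 (no _)  = 0ℚ

_≟ʷ_ : (u w : Word) → Dec (u ≡ w)
_≟ʷ_ = ≡-dec ℕₚ._≟_

δ : ℕ → ℕ → ℚ
δ c d = 𝟙 (c ℕₚ.≟ d)

𝟙-∷ : ∀ c d u w → 𝟙 ((c ∷ u) ≟ʷ (d ∷ w)) ≡ δ c d * 𝟙 (u ≟ʷ w)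
𝟙-∷ c d u w with c ℕₚ.≟ d | u ≟ʷ w
... | yes refl | yes refl = refl
... | yes refl | no _     = sym (*-zeroʳ 1ℚ)
... | no _     | u≟w      = sym (*-zeroˡ (𝟙 u≟w))

coeffTerm : Word → ℚ × Word → ℚ
coeffTerm w (q , u) = q * 𝟙 (u ≟ʷ w)

coeff≡sumOver : ∀ P w → coeff P w ≡ sumOver (coeffTerm w) P
coeff≡sumOver []            w = refl
coeff≡sumOver ((q , u) ∷ P) w with u ≟ʷ w
... | yes _ = cong₂ _+_ (sym (*-identityʳ q)) (coeff≡sumOver P w)
... | no _  = sym (trans (cong₂ _+_ (*-zeroʳ q) (sym (coeff≡sumOver P w))) (+-identityˡ _))

coeff-++ : ∀ P Q w → coeff (P ++ Q) w ≡ coeff P w + coeff Q w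
coeff-++ P Q w = begin
  coeff (P ++ Q) w                                   ≡⟨ coeff≡sumOver (P ++ Q) w ⟩
  sumOver (coeffTerm w) (P ++ Q)                     ≡⟨ sumOver-++ (coeffTerm w) P Q ⟩
  sumOver (coeffTerm w) P + sumOver (coeffTerm w) Q  ≡⟨ cong₂ _+_ (coeff≡sumOver P w) (coeff≡sumOver Q w) ⟨
  coeff P w + coeff Q w                              ∎

coeff-· : ∀ r P w → coeff (r · P) w ≡ r * coeff P w
coeff-· r P w = begin
  coeff (r · P) w                             ≡⟨ coeff≡sumOver (r · P) w ⟩
  sumOver (coeffTerm w) (r · P)               ≡⟨ sumOver-map (coeffTerm w) _ P ⟩
  sumOver (λ (q , u) → r * q * 𝟙 (u ≟ʷ w)) P  ≡⟨ sumOver-cong P (λ (q , u) → *-assoc r q _) ⟩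
  sumOver (λ t → r * coeffTerm w t) P         ≡⟨ sumOver-*ˡ r (coeffTerm w) P ⟩
  r * sumOver (coeffTerm w) P                 ≡⟨ cong (r *_) (coeff≡sumOver P w) ⟨
  r * coeff P w                               ∎

coeff-x[]*-[] : ∀ c P → coeff (x[ c ]* P) [] ≡ 0ℚ
coeff-x[]*-[] c []      = refl
coeff-x[]*-[] c (_ ∷ P) = coeff-x[]*-[] c P

coeff-x[]*-∷ : ∀ c P d w → coeff (x[ c ]* P) (d ∷ w) ≡ δ c d * coeff P w
coeff-x[]*-∷ c P d w = begin
  coeff (x[ c ]* P) (d ∷ w)                           ≡⟨ coeff≡sumOver (x[ c ]* P) (d ∷ w) ⟩
  sumOver (coeffTerm (d ∷ w)) (x[ c ]* P)             ≡⟨ sumOver-map (coeffTerm (d ∷ w)) _ P ⟩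
  sumOver (λ (q , u) → q * 𝟙 ((c ∷ u) ≟ʷ (d ∷ w))) P  ≡⟨ sumOver-cong P factor ⟩
  sumOver (λ t → δ c d * coeffTerm w t) P             ≡⟨ sumOver-*ˡ (δ c d) (coeffTerm w) P ⟩
  δ c d * sumOver (coeffTerm w) P                     ≡⟨ cong (δ c d *_) (coeff≡sumOver P w) ⟨
  δ c d * coeff P w                                   ∎
  where
  *-left-swap : ∀ a b c → a * (b * c) ≡ b * (a * c)
  *-left-swap = solve-∀ ℚ-ring
  factor : ∀ ((q , u) : ℚ × Word) → q * 𝟙 ((c ∷ u) ≟ʷ (d ∷ w)) ≡ δ c d * (q * 𝟙 (u ≟ʷ w))
  factor (q , u) = trans (cong (q *_) (𝟙-∷ c d u w)) (*-left-swap q (δ c d) (𝟙 (u ≟ʷ w)))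

coeff-swap : ∀ s t P w → coeff (s ∷ t ∷ P) w ≡ coeff (t ∷ s ∷ P) w
coeff-swap s t P w = begin
  coeff (s ∷ t ∷ P) w                                        ≡⟨ coeff≡sumOver (s ∷ t ∷ P) w ⟩
  coeffTerm w s + (coeffTerm w t + sumOver (coeffTerm w) P)  ≡⟨ +-left-swap (coeffTerm w s) (coeffTerm w t) _ ⟩
  coeffTerm w t + (coeffTerm w s + sumOver (coeffTerm w) P)  ≡⟨ coeff≡sumOver (t ∷ s ∷ P) w ⟨
  coeff (t ∷ s ∷ P) w                                        ∎
  where
  +-left-swap : ∀ a b c → a + (b + c) ≡ b + (a + c)
  +-left-swap = solve-∀ ℚ-ring

coeff-f-mono : ∀ c u v w → coeff (f c (mono u) (mono v)) w ≡ coeff (fw c u v) w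
coeff-f-mono c u v w = begin
  coeff (f c (mono u) (mono v)) w  ≡⟨ cong (λ P → coeff P w) (trans (++-identityʳ (P ++ [])) (++-identityʳ P)) ⟩
  coeff P w                        ≡⟨ coeff-· (1ℚ * 1ℚ) (fw c u v) w ⟩
  1ℚ * 1ℚ * coeff (fw c u v) w     ≡⟨ *-identityˡ _ ⟩
  coeff (fw c u v) w               ∎
  where
  P = (1ℚ * 1ℚ) · fw c u v

coeff-++₃ : ∀ P Q R w → coeff (P ++ Q ++ R) w ≡ coeff P w + coeff Q w + coeff R w
coeff-++₃ P Q R w = begin
  coeff (P ++ Q ++ R) w                  ≡⟨ coeff-++ P (Q ++ R) w ⟩
  coeff P w + coeff (Q ++ R) w           ≡⟨ cong (coeff P w +_) (coeff-++ Q R w) ⟩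
  coeff P w + (coeff Q w + coeff R w)    ≡⟨ +-assoc (coeff P w) _ _ ⟨
  coeff P w + coeff Q w + coeff R w      ∎

x[]*-++₃ : ∀ c P Q R → x[ c ]* (P ++ Q ++ R) ≡ x[ c ]* P ++ x[ c ]* Q ++ x[ c ]* R
x[]*-++₃ c P Q R = trans (map-++ _ P (Q ++ R)) (cong (x[ c ]* P ++_) (map-++ _ Q R))

fw-base-symmetric : ∀ c A B w → coeff (fw c (A ∷ []) (B ∷ [])) w ≡ coeff (fw c (B ∷ []) (A ∷ [])) w
fw-base-symmetric c A B w =
  trans (coeff-swap cAB cBA (last (c ℕ.+ A ℕ.+ B)) w)
        (cong (λ n → coeff (cBA ∷ cAB ∷ last n) w) (xy∙z≈xz∙y c A B))
  where
  last : ℕ → 𝔛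
  last n = ((- 1ℚ) * 1ℚ , n ∷ []) ∷ []
  cAB = 1ℚ , c ∷ A ∷ B ∷ []
  cBA = 1ℚ , c ∷ B ∷ A ∷ []

-- The terms of f_c(x_A, x_B x_z V) except x_c x_B f_z(x_A, V), after expanding f_c and then f_B.
symmetricPart : ℕ → ℕ → ℕ → ℕ → Word → 𝔛
symmetricPart c A B z V =
  x[ c ]* (fw A [] (B ∷ z ∷ V)) ++ x[ c ]* (x[ B ]* (fw A [] (z ∷ V))) ++
  x[ c ]* ((- 1ℚ) · fw (B ℕ.+ A ℕ.+ z) [] V) ++ (- 1ℚ) · fw (c ℕ.+ A ℕ.+ B) [] (z ∷ V)

fw-split : ∀ c A B z V w →
           coeff (fw c (A ∷ []) (B ∷ z ∷ V)) w
             ≡ coeff (symmetricPart c A B z V) w + coeff (x[ c ]* (x[ B ]* (fw z (A ∷ []) V))) w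
fw-split c A B z V w = begin
  coeff (X₁ ++ x[ c ]* (P₁ ++ P₂ ++ P₃) ++ X₃) w
    ≡⟨ cong (λ M → coeff (X₁ ++ M ++ X₃) w) (x[]*-++₃ c P₁ P₂ P₃) ⟩
  coeff (X₁ ++ (Y₁ ++ Y₂ ++ Y₃) ++ X₃) w
    ≡⟨ coeff-++₃ X₁ (Y₁ ++ Y₂ ++ Y₃) X₃ w ⟩
  coeff X₁ w + coeff (Y₁ ++ Y₂ ++ Y₃) w + coeff X₃ w
    ≡⟨ cong (λ y → coeff X₁ w + y + coeff X₃ w) (coeff-++₃ Y₁ Y₂ Y₃ w) ⟩
  coeff X₁ w + (coeff Y₁ w + coeff Y₂ w + coeff Y₃ w) + coeff X₃ w
    ≡⟨ rearrange (coeff X₁ w) (coeff Y₁ w) (coeff Y₂ w) (coeff Y₃ w) (coeff X₃ w) ⟩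
  coeff X₁ w + coeff Y₁ w + (coeff Y₃ w + coeff X₃ w) + coeff Y₂ w
    ≡⟨ cong (_+ coeff Y₂ w) symmetricPart-coeff ⟨
  coeff (symmetricPart c A B z V) w + coeff Y₂ w ∎
  where
  X₁ = x[ c ]* (fw A [] (B ∷ z ∷ V))
  X₃ = (- 1ℚ) · fw (c ℕ.+ A ℕ.+ B) [] (z ∷ V)
  P₁ = x[ B ]* (fw A [] (z ∷ V))
  P₂ = x[ B ]* (fw z (A ∷ []) V)
  P₃ = (- 1ℚ) · fw (B ℕ.+ A ℕ.+ z) [] V
  Y₁ = x[ c ]* P₁
  Y₂ = x[ c ]* P₂
  Y₃ = x[ c ]* P₃
  symmetricPart-coeff : coeff (symmetricPart c A B z V) w
                      ≡ coeff X₁ w + coeff Y₁ w + (coeff Y₃ w + coeff X₃ w)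
  symmetricPart-coeff = trans (coeff-++₃ X₁ Y₁ (Y₃ ++ X₃) w)
                              (cong (coeff X₁ w + coeff Y₁ w +_) (coeff-++ Y₃ X₃ w))
  rearrange : ∀ x₁ y₁ y₂ y₃ x₃ → x₁ + (y₁ + y₂ + y₃) + x₃ ≡ x₁ + y₁ + (y₃ + x₃) + y₂
  rearrange = solve-∀ ℚ-ring

symmetricPart-symmetric : ∀ c A B z V w →
                          coeff (symmetricPart c B A z V) w ≡ coeff (symmetricPart c A B z V) w
symmetricPart-symmetric c A B z V w =
  trans (coeff-swap cBA cAB (rest (A ℕ.+ B ℕ.+ z) (c ℕ.+ B ℕ.+ A)) w)
        (cong₂ (λ p q → coeff (cAB ∷ cBA ∷ rest p q) w)
               (cong (ℕ._+ z) (ℕₚ.+-comm A B)) (xy∙z≈xz∙y c B A))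
  where
  rest : ℕ → ℕ → 𝔛
  rest p q = x[ c ]* ((- 1ℚ) · fw p [] V) ++ (- 1ℚ) · fw q [] (z ∷ V)
  cAB = 1ℚ , c ∷ A ∷ B ∷ z ∷ V
  cBA = 1ℚ , c ∷ B ∷ A ∷ z ∷ V

module _ {m : ℕ} (a : Fin m → ℕ) where

  fCoeff : ℕ → List ℕ → Word → List (Fin m) → ℚ
  fCoeff c zs w []      = 0ℚ
  fCoeff c zs w (α ∷ σ) = coeff (fw c (a α ∷ []) (interleave (map a σ) zs)) w

  symmetricCoeff : ℕ → ℕ → List ℕ → Word → List (Fin m) → ℚ
  symmetricCoeff c z zs w (α ∷ β ∷ γ ∷ σ) =
    coeff (symmetricPart c (a α) (a β) z (interleave (map a (γ ∷ σ)) zs)) w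
  symmetricCoeff c z zs w _               = 0ℚ

  remainderCoeff : ℕ → ℕ → List ℕ → Word → List (Fin m) → ℚ
  remainderCoeff c z zs (d ∷ e ∷ w) σ = δ c d * dropSecond (λ β → δ (a β) e) (fCoeff z zs w) σ
  remainderCoeff c z zs _           σ = 0ℚ

  coeff-remainder : ∀ c z zs w α β γ σ →
    coeff (x[ c ]* (x[ a β ]* (fw z (a α ∷ []) (interleave (map a (γ ∷ σ)) zs)))) w
      ≡ remainderCoeff c z zs w (α ∷ β ∷ γ ∷ σ)
  coeff-remainder c z zs []          α β γ σ = coeff-x[]*-[] c (x[ a β ]* Y)
    where Y = fw z (a α ∷ []) (interleave (map a (γ ∷ σ)) zs)
  coeff-remainder c z zs (d ∷ [])    α β γ σ = begin
    coeff (x[ c ]* (x[ a β ]* Y)) (d ∷ [])   ≡⟨ coeff-x[]*-∷ c (x[ a β ]* Y) d [] ⟩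
    δ c d * coeff (x[ a β ]* Y) []           ≡⟨ cong (δ c d *_) (coeff-x[]*-[] (a β) Y) ⟩
    δ c d * 0ℚ                               ≡⟨ *-zeroʳ (δ c d) ⟩
    0ℚ                                       ∎
    where Y = fw z (a α ∷ []) (interleave (map a (γ ∷ σ)) zs)
  coeff-remainder c z zs (d ∷ e ∷ w) α β γ σ =
    trans (coeff-x[]*-∷ c (x[ a β ]* Y) d (e ∷ w)) (cong (δ c d *_) (coeff-x[]*-∷ (a β) Y e w))
    where Y = fw z (a α ∷ []) (interleave (map a (γ ∷ σ)) zs)

  fCoeff-split : ∀ c z zs w σ → length σ ≡ 3 ℕ.+ length zs →
                 fCoeff c (z ∷ zs) w σ ≡ symmetricCoeff c z zs w σ + remainderCoeff c z zs w σ
  fCoeff-split c z zs w (α ∷ β ∷ γ ∷ σ) _ =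
    trans (fw-split c (a α) (a β) z (interleave (map a (γ ∷ σ)) zs) w)
          (cong (symmetricCoeff c z zs w (α ∷ β ∷ γ ∷ σ) +_) (coeff-remainder c z zs w α β γ σ))

  symmetricCoeff-symmetric : ∀ c z zs w →
                             SumOfSymmetric (3 ℕ.+ length zs) (symmetricCoeff c z zs w)
  symmetricCoeff-symmetric c z zs w = symmetric 0 (s≤s (s≤s z≤n)) invariant
    where
    invariant : ∀ σ → length σ ≡ 3 ℕ.+ length zs →
                symmetricCoeff c z zs w (swapHead 0 σ) ≡ symmetricCoeff c z zs w σ
    invariant (α ∷ β ∷ γ ∷ σ) _ = symmetricPart-symmetric c (a α) (a β) z _ w

  fCoeff-SumOfSymmetric : ∀ zs c w → SumOfSymmetric (2 ℕ.+ length zs) (fCoeff c zs w)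
  fCoeff-SumOfSymmetric [] c w = symmetric 0 ℕₚ.≤-refl invariant
    where
    invariant : ∀ σ → length σ ≡ 2 → fCoeff c [] w (swapHead 0 σ) ≡ fCoeff c [] w σ
    invariant (α ∷ β ∷ []) _ = fw-base-symmetric c (a β) (a α) w
  fCoeff-SumOfSymmetric (z ∷ zs) c w =
    plus (symmetricCoeff-symmetric c z zs w) (remainder w) (fCoeff-split c z zs w)
    where
    remainder : ∀ w → SumOfSymmetric (3 ℕ.+ length zs) (remainderCoeff c z zs w)
    remainder []          = SumOfSymmetric-zero (s≤s (s≤s z≤n))
    remainder (d ∷ [])    = SumOfSymmetric-zero (s≤s (s≤s z≤n))
    remainder (d ∷ e ∷ w) = SumOfSymmetric-scale (δ c d)
      (SumOfSymmetric-dropSecond (λ β → δ (a β) e) (fCoeff-SumOfSymmetric zs z w))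

coeff-∑ : ∀ Ps w → coeff (∑ Ps) w ≡ sumOver (λ P → coeff P w) Ps
coeff-∑ []       w = refl
coeff-∑ (P ∷ Ps) w = trans (coeff-++ P (∑ Ps) w) (cong (coeff P w +_) (coeff-∑ Ps w))

coeff-summand : ∀ k a b w σ →
                coeff (summand k a b σ) w ≡ sgn σ * fCoeff a (b zero) (tabulate (b ∘ suc)) w σ
coeff-summand k a b w []      = refl
coeff-summand k a b w (α ∷ σ) =
  trans (coeff-· (sgn (α ∷ σ)) (f (b zero) (mono (a α ∷ [])) (mono V)) w)
        (cong (sgn (α ∷ σ) *_) (coeff-f-mono (b zero) (a α ∷ []) V w))
  where
  V = interleave (map a σ) (tabulate (b ∘ suc))

lemma2p5 : (k : ℕ) (a : Fin (suc (suc k)) → ℕ) (b : Fin (suc k) → ℕ) →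
    (∀ i → 1 ≤ a i) → (∀ j → 1 ≤ b j) →
    IsZero (altSum k a b)
lemma2p5 k a b _ _ w = begin
  coeff (altSum k a b) w                                     ≡⟨ coeff-∑ (map (summand k a b) (perms L)) w ⟩
  sumOver (λ P → coeff P w) (map (summand k a b) (perms L))  ≡⟨ sumOver-map _ (summand k a b) (perms L) ⟩
  sumOver (λ σ → coeff (summand k a b σ) w) (perms L)        ≡⟨ sumOver-cong (perms L) (coeff-summand k a b w) ⟩
  alternatingSum L (fCoeff a (b zero) zs w)                  ≡⟨ alternatingSum-vanishes
                                                                  (fCoeff-SumOfSymmetric a zs (b zero) w)
                                                                  L (tabulate⁺ (λ i≡j → i≡j)) ∣L∣≡2+∣zs∣ ⟩
  0ℚ                                                         ∎
  where
  L = allFinL (suc (suc k))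
  zs = tabulate (b ∘ suc)
  ∣L∣≡2+∣zs∣ : length L ≡ 2 ℕ.+ length zs
  ∣L∣≡2+∣zs∣ = trans (length-tabulate (λ i → i)) (cong (2 ℕ.+_) (sym (length-tabulate (b ∘ suc))))
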